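{- $R_{4,2}(K_3)=9$.
   Context: A $(4,2)$-colouring of a graph $G$ is a function $\varphi:E(G)\to\binom{[4]}{2}$, assigning to each edge a set of exactly $2$ colours from $\{1,2,3,4\}$. A subgraph $H\subseteq G$ is monochromatic if there is a colour $i$ with $i\in\varphi(e)$ for every $e\in E(H)$. $R_{4,2}(K_3)$ is the smallest $n$ such that every $(4,2)$-colouring of $K_n$ contains a monochromatic triangle. -}

module Defs where

open import Data.Nat using (ℕ; _<_)
open import Data.Fin using (Fin) renaming (_<_ to _<ᶠ_)
open import Data.Product using (Σ; ∃-syntax; _×_; _,_)
open import Data.Sum using (_⊎_)
open import Relation.Nullary using (¬_)
open import Relation.Binary.PropositionalEquality using (_≡_)

Colours2 : Set
Colours2 = Σ (Fin 4) λ a → Σ (Fin 4) λ b → a <ᶠ b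

_∈₂_ : Fin 4 → Colours2 → Set
c ∈₂ (a , b , _) = c ≡ a ⊎ c ≡ b

Colouring42 : ℕ → Set
Colouring42 n = (i j : Fin n) → i <ᶠ j → Colours2

HasMonoTriangle : ∀ {n} → Colouring42 n → Set
HasMonoTriangle {n} φ =
  ∃[ i ] ∃[ j ] ∃[ k ] Σ (i <ᶠ j) λ ij → Σ (j <ᶠ k) λ jk → Σ (i <ᶠ k) λ ik →
    ∃[ c ] (c ∈₂ φ i j ij × c ∈₂ φ j k jk × c ∈₂ φ i k ik)

Arrows : ℕ → Set
Arrows n = (φ : Colouring42 n) → HasMonoTriangle φ

R42K3≡ : ℕ → Set
R42K3≡ r = Arrows r × (∀ m → m < r → ¬ Arrows m)

-- In a (4,2)-colouring of K₉ without monochromatic triangle every colour class is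
-- a triangle-free graph. No vertex x has five neighbours in a class c: fix one of them, y; the
-- edges from y to the (at least four) others avoid c, so each misses exactly one further colour
-- d ≠ c, and by pigeonhole two of them, yz₁ and yz₂, miss the same d. They then carry the same
-- two colours, and z₁z₂, which avoids c as well, shares one of them: a monochromatic triangle.
-- Since the colour degrees at a vertex add up to 2·8 = 16, every colour class is 4-regular. But
-- a triangle-free d-regular graph on 2d + 1 vertices has d ≤ 2: for an edge uv the neighbourhoods
-- N(u) and N(v) are disjoint and miss a single vertex w, so N(w) ⊆ N(u) ∪ N(v). A common
-- neighbour of w and u has all its neighbours but w in N(v) ∖ N(w), so w and v share at most one
-- neighbour; by symmetry the same holds for w and u, whence d = |N(w)| ≤ 2.
-- Lower bound: an explicit colouring of K₈, checked exhaustively.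

module Submission where

open import Defs
open import Data.Bool using (if_then_else_)
open import Data.Empty using (⊥-elim)
import Data.Empty as Empty
open import Data.Fin using (Fin; zero; suc; punchIn; inject≤) renaming (_<_ to _<ᶠ_)
open import Data.Fin.Patterns using (0F; 1F; 2F; 3F)
open import Data.Fin.Properties using (_≟_; all?; any?; punchInᵢ≢i; <-cmp; <-irrefl; <-asym; toℕ-inject≤) renaming (_<?_ to _<ᶠ?_; <-trans to <ᶠ-trans; <-irrelevant to <ᶠ-irrelevant)
open import Data.Nat as ℕ using (ℕ; zero; suc; _+_; _*_; _≤_; _<_; z≤n; s≤s; s≤s⁻¹; z<s; s<s)
open import Data.Nat.Properties using (≤-refl; ≤-reflexive; ≤-trans; ≤-antisym; <-trans; _<?_; ≮⇒≥; <⇒≱; >⇒≢; +-comm; +-identityʳ; *-identityʳ; *-zeroʳ; +-mono-≤; +-monoˡ-≤; +-monoʳ-≤; +-cancelˡ-≡; +-cancelʳ-≤; m<m+n; +-0-commutativeMonoid; module ≤-Reasoning)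
open import Algebra.Properties.CommutativeMonoid.Sum +-0-commutativeMonoid using (sum; sum-syntax; ∑-comm; ∑-distrib-+; sum-remove; sum-cong-≗)
open import Data.Product using (∃-syntax; _×_; _,_; proj₁; proj₂)
open import Data.Sum as ⊎ using (_⊎_; inj₁; inj₂; [_,_])
open import Data.Vec using (Vec; []; _∷_; lookup)
open import Data.Vec.Functional using (removeAt)
open import Function using (_∘_)
open import Level using (Level; 0ℓ)
open import Relation.Binary using (Rel; Symmetric; tri<; tri≈; tri>)
open import Relation.Binary.Definitions using () renaming (Decidable to Decidable₂)
open import Relation.Binary.PropositionalEquality using (_≡_; _≢_; refl; sym; trans; cong; cong₂; subst; subst₂; module ≡-Reasoning)
open import Relation.Nullary using (¬_; Dec; yes; no; does; contradiction; map′; ¬?; _⊎-dec_; _×-dec_; _→-dec_)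
open import Relation.Nullary.Decidable using (from-yes; from-no; decidable-stable)
open import Relation.Unary using (Pred; Decidable; Satisfiable; _⊆_; _⊥_; _≐_; _∩_; _∪_; ∁; ｛_｝)
open import Relation.Unary.Properties using (_∩?_; _∪?_; ∁?; does-≐)

private variable
  ℓ ℓ′ : Level
  n k : ℕ

-- Finite sums and counting

∑-mono-≤ : {f g : Fin n → ℕ} → (∀ i → f i ≤ g i) → ∑[ i < n ] f i ≤ ∑[ i < n ] g i
∑-mono-≤ {zero}  _   = z≤n
∑-mono-≤ {suc n} f≤g = +-mono-≤ (f≤g zero) (∑-mono-≤ (f≤g ∘ suc))

∑-const : ∀ n k → ∑[ i < n ] k ≡ n * k
∑-const zero    k = refl
∑-const (suc n) k = cong (k +_) (∑-const n k)

∑-≤-* : {f : Fin n → ℕ} → (∀ i → f i ≤ k) → ∑[ i < n ] f i ≤ n * k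
∑-≤-* {n} {k} f≤k = ≤-trans (∑-mono-≤ f≤k) (≤-reflexive (∑-const n k))

pigeonhole-∑ : (f : Fin n → ℕ) → n * k < ∑[ i < n ] f i → ∃[ i ] k < f i
pigeonhole-∑ {k = k} f nk<∑ with any? (λ i → k <? f i)
... | yes k<fi = k<fi
... | no  ∄    = contradiction (∑-≤-* (λ i → ≮⇒≥ (∄ ∘ (i ,_)))) (<⇒≱ nk<∑)

∑-≤-*⇒≡ : {f : Fin n → ℕ} → (∀ i → f i ≤ k) → n * k ≤ ∑[ i < n ] f i → ∀ i → f i ≡ k
∑-≤-*⇒≡ {suc n} {k} {f} f≤k nk≤∑ i = ≤-antisym (f≤k i) (+-cancelʳ-≤ (n * k) k (f i) (begin
  k + n * k                 ≤⟨ nk≤∑ ⟩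
  ∑[ j < suc n ] f j        ≡⟨ sum-remove f ⟩
  f i + sum (removeAt f i)  ≤⟨ +-monoʳ-≤ (f i) (∑-≤-* (f≤k ∘ punchIn i)) ⟩
  f i + n * k               ∎))
  where open ≤-Reasoning

indicator : {P : Pred (Fin n) ℓ} → Decidable P → Fin n → ℕ
indicator P? i = if does (P? i) then 1 else 0

count : {P : Pred (Fin n) ℓ} → Decidable P → ℕ
count {n} P? = ∑[ i < n ] indicator P? i

module _ {P : Pred (Fin n) ℓ} {Q : Pred (Fin n) ℓ′} (P? : Decidable P) (Q? : Decidable Q) where

  count-mono : P ⊆ Q → count P? ≤ count Q?
  count-mono P⊆Q = ∑-mono-≤ pointwise
    where
    pointwise : ∀ i → indicator P? i ≤ indicator Q? i
    pointwise i with P? i | Q? i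
    ... | yes p | no ¬q = contradiction (P⊆Q p) ¬q
    ... | yes _ | yes _ = ≤-refl
    ... | no _  | _     = z≤n

  count-cong : P ≐ Q → count P? ≡ count Q?
  count-cong P≐Q = sum-cong-≗ λ i → cong (λ b → if b then 1 else 0) (does-≐ P≐Q P? Q? i)

  count-∪ : count (P? ∪? Q?) ≤ count P? + count Q?
  count-∪ = ≤-trans (∑-mono-≤ pointwise) (≤-reflexive (∑-distrib-+ (indicator P?) (indicator Q?)))
    where
    pointwise : ∀ i → indicator (P? ∪? Q?) i ≤ indicator P? i + indicator Q? i
    pointwise i with P? i | Q? i
    ... | yes _ | _     = s≤s z≤n
    ... | no _  | yes _ = ≤-refl
    ... | no _  | no _  = z≤n

  count-∪-disjoint : P ⊥ Q → count (P? ∪? Q?) ≡ count P? + count Q?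
  count-∪-disjoint disjoint = trans (sum-cong-≗ pointwise) (∑-distrib-+ (indicator P?) (indicator Q?))
    where
    pointwise : ∀ i → indicator (P? ∪? Q?) i ≡ indicator P? i + indicator Q? i
    pointwise i with P? i | Q? i
    ... | yes p | yes q = ⊥-elim (disjoint (p , q))
    ... | yes _ | no _  = refl
    ... | no _  | yes _ = refl
    ... | no _  | no _  = refl

  count-split : count P? ≡ count (P? ∩? Q?) + count (P? ∩? ∁? Q?)
  count-split = trans (sum-cong-≗ pointwise) (∑-distrib-+ (indicator (P? ∩? Q?)) (indicator (P? ∩? ∁? Q?)))
    where
    pointwise : ∀ i → indicator P? i ≡ indicator (P? ∩? Q?) i + indicator (P? ∩? ∁? Q?) i
    pointwise i with P? i | Q? i
    ... | yes _ | yes _ = refl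
    ... | yes _ | no _  = refl
    ... | no _  | _     = refl

module _ {P : Pred (Fin n) ℓ} (P? : Decidable P) where

  indicator-yes : ∀ {i} → P i → indicator P? i ≡ 1
  indicator-yes {i} pᵢ with P? i
  ... | yes _  = refl
  ... | no ¬pᵢ = contradiction pᵢ ¬pᵢ

  indicator-no : ∀ {i} → ¬ P i → indicator P? i ≡ 0
  indicator-no {i} ¬pᵢ with P? i
  ... | yes pᵢ = contradiction pᵢ ¬pᵢ
  ... | no _   = refl

  count-∁ : count P? + count (∁? P?) ≡ n
  count-∁ = begin
    count P? + count (∁? P?)                            ≡⟨ ∑-distrib-+ (indicator P?) (indicator (∁? P?)) ⟨
    ∑[ i < n ] (indicator P? i + indicator (∁? P?) i)   ≡⟨ sum-cong-≗ pointwise ⟩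
    ∑[ i < n ] 1                                        ≡⟨ ∑-const n 1 ⟩
    n * 1                                               ≡⟨ *-identityʳ n ⟩
    n                                                   ∎
    where
    open ≡-Reasoning
    pointwise : ∀ i → indicator P? i + indicator (∁? P?) i ≡ 1
    pointwise i with P? i
    ... | yes _ = refl
    ... | no _  = refl

  count-∅ : (∀ i → ¬ P i) → count P? ≡ 0
  count-∅ ∄P = trans (sum-cong-≗ pointwise) (trans (∑-const n 0) (*-zeroʳ n))
    where
    pointwise : ∀ i → indicator P? i ≡ 0
    pointwise i with P? i
    ... | yes p = contradiction p (∄P i)
    ... | no _  = refl

  0<count⇒satisfiable : 0 < count P? → Satisfiable P
  0<count⇒satisfiable 0<count with any? P?
  ... | yes ∃P = ∃P
  ... | no  ∄P = contradiction (count-∅ (λ i p → ∄P (i , p))) (>⇒≢ 0<count)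

count-｛｝ : (x : Fin n) → count (x ≟_) ≡ 1
count-｛｝ {suc n} zero    = cong suc (count-∅ {n = n} (λ i → zero ≟ suc i) λ _ ())
count-｛｝ {suc n} (suc x) = count-｛｝ x

module _ {P : Pred (Fin n) ℓ} (P? : Decidable P) where

  satisfiable⇒0<count : Satisfiable P → 0 < count P?
  satisfiable⇒0<count (i , pᵢ) = begin-strict
    0              <⟨ z<s ⟩
    1              ≡⟨ count-｛｝ i ⟨
    count (i ≟_)   ≤⟨ count-mono (i ≟_) P? (λ { refl → pᵢ }) ⟩
    count P?       ∎
    where open ≤-Reasoning

  count-∖｛｝ : ∀ i → count P? ≤ suc (count (P? ∩? ∁? (i ≟_)))
  count-∖｛｝ i = begin
    count P?                                       ≡⟨ count-split P? (i ≟_) ⟩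
    count (P? ∩? (i ≟_)) + count (P? ∩? ∁? (i ≟_)) ≤⟨ +-monoˡ-≤ _ at-most-i ⟩
    1 + count (P? ∩? ∁? (i ≟_))                    ∎
    where
    open ≤-Reasoning
    at-most-i : count (P? ∩? (i ≟_)) ≤ 1
    at-most-i = ≤-trans (count-mono (P? ∩? (i ≟_)) (i ≟_) proj₂) (≤-reflexive (count-｛｝ i))

  count-two : 1 < count P? → ∃[ i ] ∃[ j ] i ≢ j × P i × P j
  count-two 1<count with 0<count⇒satisfiable P? (<-trans z<s 1<count)
  ... | i , pᵢ with 0<count⇒satisfiable (P? ∩? ∁? (i ≟_)) (s≤s⁻¹ (≤-trans 1<count (count-∖｛｝ i)))
  ...   | j , pⱼ , i≢j = i , j , i≢j , pᵢ , pⱼ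

  count≤1⇒unique : count P? ≤ 1 → ∀ {i j} → P i → P j → i ≡ j
  count≤1⇒unique count≤1 {i} {j} pᵢ pⱼ with i ≟ j
  ... | yes i≡j = i≡j
  ... | no  i≢j = contradiction count≤1 (<⇒≱ (begin-strict
        1                                  <⟨ s≤s (s≤s z≤n) ⟩
        1 + 1                              ≡⟨ cong₂ _+_ (count-｛｝ i) (count-｛｝ j) ⟨
        count (i ≟_) + count (j ≟_)        ≡⟨ count-∪-disjoint (i ≟_) (j ≟_) (λ (i≡x , j≡x) → i≢j (trans i≡x (sym j≡x))) ⟨
        count ((i ≟_) ∪? (j ≟_))           ≤⟨ count-mono ((i ≟_) ∪? (j ≟_)) P? [ (λ { refl → pᵢ }) , (λ { refl → pⱼ }) ] ⟩
        count P?                           ∎))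
    where open ≤-Reasoning

-- Triangle-free regular graphs

degree : ∀ {n ℓ} {E : Rel (Fin n) ℓ} → Decidable₂ E → Fin n → ℕ
degree E? x = count (E? x)

TriangleFree : ∀ {a ℓ} {A : Set a} → Rel A ℓ → Set _
TriangleFree E = ∀ {x y z} → E x y → E y z → ¬ E x z

private
  split-bound : ∀ {d k l} → d ≤ k + l → k < d → l < d → (0 < k → l ≤ 1) → (0 < l → k ≤ 1) → d ≤ 2
  split-bound {k = zero}          d≤l   _   l<d _   _   = contradiction d≤l (<⇒≱ l<d)
  split-bound {k = suc k} {zero}  d≤k+0 k<d _   _   _   = contradiction (≤-trans d≤k+0 (≤-reflexive (+-identityʳ (suc k)))) (<⇒≱ k<d)
  split-bound {k = suc k} {suc l} d≤k+l _   _   l≤1 k≤1 = ≤-trans d≤k+l (+-mono-≤ (k≤1 z<s) (l≤1 z<s))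

module _ {d ℓ} {E : Rel (Fin (suc (d + d))) ℓ} (E? : Decidable₂ E)
         (E-sym : Symmetric E) (E-irrefl : ∀ {x} → ¬ E x x) (triangle-free : TriangleFree E)
         (regular : ∀ x → degree E? x ≡ d) where

  private
    module Edge {u v} (u~v : E u v) where

      U? : Decidable (E u ∪ E v)
      U? = E? u ∪? E? v

      count-U : count U? ≡ d + d
      count-U = trans (count-∪-disjoint (E? u) (E? v) (λ (u~y , v~y) → triangle-free u~v v~y u~y))
                      (cong₂ _+_ (regular u) (regular v))

      count-∁U : count (∁? U?) ≡ 1
      count-∁U = +-cancelˡ-≡ (d + d) _ _ (begin
        d + d + count (∁? U?)      ≡⟨ cong (_+ count (∁? U?)) count-U ⟨
        count U? + count (∁? U?)   ≡⟨ count-∁ U? ⟩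
        suc (d + d)                ≡⟨ +-comm 1 (d + d) ⟩
        d + d + 1                  ∎)
        where open ≡-Reasoning

      module Outside {w} (w∉U : ¬ (E u w ⊎ E v w)) where

        only-w : ∀ {y} → ¬ E u y → ¬ E v y → y ≡ w
        only-w u≁y v≁y = count≤1⇒unique (∁? U?) (≤-reflexive count-∁U) [ u≁y , v≁y ] w∉U

        w-neighbours : ∀ {y} → E w y → E u y ⊎ E v y
        w-neighbours {y} w~y with U? y
        ... | yes y∈U = y∈U
        ... | no  y∉U with only-w (y∉U ∘ inj₁) (y∉U ∘ inj₂)
        ...   | refl = contradiction w~y E-irrefl

        common exclusive : Fin (suc (d + d)) → ℕ
        common    q = count (E? q ∩? E? w)
        exclusive q = count (E? q ∩? ∁? (E? w))

        common+exclusive : ∀ q → common q + exclusive q ≡ d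
        common+exclusive q = trans (sym (count-split (E? q) (E? w))) (regular q)

        few-common : ∀ {p q} → (∀ {y} → ¬ E p y → ¬ E q y → y ≡ w) → 0 < common p → common q ≤ 1
        few-common {p} {q} unique-outside 0<common with 0<count⇒satisfiable (E? p ∩? E? w) 0<common
        ... | a , p~a , w~a = +-cancelʳ-≤ (exclusive q) (common q) 1 (begin
          common q + exclusive q                  ≡⟨ common+exclusive q ⟩
          d                                       ≡⟨ regular a ⟨
          count (E? a)                            ≤⟨ count-mono (E? a) ((w ≟_) ∪? (E? q ∩? ∁? (E? w))) a-neighbours ⟩
          count ((w ≟_) ∪? (E? q ∩? ∁? (E? w)))   ≤⟨ count-∪ (w ≟_) (E? q ∩? ∁? (E? w)) ⟩
          count (w ≟_) + exclusive q              ≡⟨ cong (_+ exclusive q) (count-｛｝ w) ⟩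
          1 + exclusive q                         ∎)
          where
          open ≤-Reasoning
          a-neighbours : ∀ {y} → E a y → w ≡ y ⊎ (E q y × ¬ E w y)
          a-neighbours {y} a~y with E? q y
          ... | yes q~y = inj₂ (q~y , triangle-free w~a a~y)
          ... | no  q≁y = inj₁ (sym (unique-outside (triangle-free p~a a~y) q≁y))

        common<d : ∀ {p q} → E p q → ¬ E w p → common q < d
        common<d {p} {q} p~q w≁p = begin-strict
          common q                <⟨ m<m+n (common q) (satisfiable⇒0<count (E? q ∩? ∁? (E? w)) (p , E-sym p~q , w≁p)) ⟩
          common q + exclusive q  ≡⟨ common+exclusive q ⟩
          d                       ∎
          where open ≤-Reasoning

        d≤common : d ≤ common u + common v
        d≤common = begin
          d                                              ≡⟨ regular w ⟨
          count (E? w)                                   ≤⟨ count-mono (E? w) ((E? u ∩? E? w) ∪? (E? v ∩? E? w)) split-w ⟩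
          count ((E? u ∩? E? w) ∪? (E? v ∩? E? w))       ≤⟨ count-∪ (E? u ∩? E? w) (E? v ∩? E? w) ⟩
          common u + common v                            ∎
          where
          open ≤-Reasoning
          split-w : ∀ {y} → E w y → (E u y × E w y) ⊎ (E v y × E w y)
          split-w w~y = ⊎.map (_, w~y) (_, w~y) (w-neighbours w~y)

        d≤2 : d ≤ 2
        d≤2 = split-bound d≤common
          (common<d (E-sym u~v) (w∉U ∘ inj₂ ∘ E-sym))
          (common<d u~v (w∉U ∘ inj₁ ∘ E-sym))
          (few-common only-w)
          (few-common (λ v≁y u≁y → only-w u≁y v≁y))

  regular-triangle-free⇒≤2 : d ≤ 2
  regular-triangle-free⇒≤2 with any? (E? zero)
  ... | no  isolated  = ≤-trans (≤-reflexive d≡0) z≤n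
    where
    d≡0 : d ≡ 0
    d≡0 = trans (sym (regular zero)) (count-∅ (E? zero) (λ v u~v → isolated (v , u~v)))
  ... | yes (_ , u~v) with 0<count⇒satisfiable (∁? (Edge.U? u~v)) (≤-reflexive (sym (Edge.count-∁U u~v)))
  ...   | _ , w∉U = Edge.Outside.d≤2 u~v w∉U

_∈₂?_ : (c : Fin 4) (p : Colours2) → Dec (c ∈₂ p)
c ∈₂? (a , b , _) = (c ≟ a) ⊎-dec (c ≟ b)

all-Colours2? : ∀ {ℓ} {P : Pred Colours2 ℓ} → Decidable P → Dec (∀ p → P p)
all-Colours2? {P = P} P? = map′ (λ ∀P (a , b , a<b) → ∀P a b a<b) (λ ∀P a b a<b → ∀P (a , b , a<b))
                                (all? λ a → all? λ b → for-pair a b)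
  where
  for-pair : ∀ a b → Dec (∀ a<b → P (a , b , a<b))
  for-pair a b with a <ᶠ? b
  ... | yes a<b = map′ (λ Pab a<b′ → subst (λ h → P (a , b , h)) (<ᶠ-irrelevant a<b a<b′) Pab) (λ ∀P → ∀P a<b) (P? (a , b , a<b))
  ... | no  a≮b = yes λ a<b → contradiction a<b a≮b

-- Opaque, so that conversion checking never unfolds these exhaustive searches.
opaque
  count-∈₂ : ∀ p → count (_∈₂? p) ≡ 2
  count-∈₂ = from-yes (all-Colours2? λ p → count (_∈₂? p) ℕ.≟ 2)

  count-∉₂ : ∀ p → count (∁? (_∈₂? p)) ≡ 2
  count-∉₂ = from-yes (all-Colours2? λ p → count (∁? (_∈₂? p)) ℕ.≟ 2)

  common-colour : ∀ p q r {c d} → c ≢ d → ¬ c ∈₂ p → ¬ d ∈₂ p → ¬ c ∈₂ q → ¬ d ∈₂ q → ¬ c ∈₂ r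
                → ∃[ e ] (e ∈₂ p × e ∈₂ q × e ∈₂ r)
  common-colour p q r {c} {d} = from-yes
    (all-Colours2? λ p → all-Colours2? λ q → all-Colours2? λ r → all? λ c → all? λ d →
      ¬? (c ≟ d) →-dec ¬? (c ∈₂? p) →-dec ¬? (d ∈₂? p) →-dec ¬? (c ∈₂? q) →-dec ¬? (d ∈₂? q) →-dec ¬? (c ∈₂? r) →-dec
      any? λ e → (e ∈₂? p) ×-dec (e ∈₂? q) ×-dec (e ∈₂? r)) p q r c d

module _ {n ℓ} {R : Rel (Fin n) ℓ} (R-sym : Symmetric R) (R-irrefl : ∀ {x} → ¬ R x x) where

  sort-triangle : ∀ {x y z} → R x y → R y z → R x z
                → ∃[ i ] ∃[ j ] ∃[ k ] (i <ᶠ j × j <ᶠ k × R i j × R j k × R i k)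
  sort-triangle {x} {y} {z} xy yz xz with <-cmp x y | <-cmp y z | <-cmp x z
  ... | tri≈ _ refl _ | _             | _             = contradiction xy R-irrefl
  ... | _             | tri≈ _ refl _ | _             = contradiction yz R-irrefl
  ... | _             | _             | tri≈ _ refl _ = contradiction xz R-irrefl
  ... | tri< x<y _ _  | tri< y<z _ _  | _             = x , y , z , x<y , y<z , xy , yz , xz
  ... | tri< x<y _ _  | tri> _ _ z<y  | tri< x<z _ _  = x , z , y , x<z , z<y , xz , R-sym yz , xy
  ... | tri< x<y _ _  | tri> _ _ z<y  | tri> _ _ z<x  = z , x , y , z<x , x<y , R-sym xz , xy , R-sym yz
  ... | tri> _ _ y<x  | _             | tri< x<z _ _  = y , x , z , y<x , x<z , R-sym xy , xz , yz
  ... | tri> _ _ y<x  | tri< y<z _ _  | tri> _ _ z<x  = y , z , x , y<z , z<x , yz , R-sym xz , R-sym xy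
  ... | tri> _ _ y<x  | tri> _ _ z<y  | tri> _ _ z<x  = z , y , x , z<y , y<x , R-sym yz , R-sym xy , R-sym xz

module _ {n} (φ : Colouring42 n) where

  ColourClass : Fin 4 → Rel (Fin n) 0ℓ
  ColourClass c x y with <-cmp x y
  ... | tri< x<y _ _ = c ∈₂ φ x y x<y
  ... | tri≈ _ _ _   = Empty.⊥
  ... | tri> _ _ y<x = c ∈₂ φ y x y<x

  colourClass? : ∀ c → Decidable₂ (ColourClass c)
  colourClass? c x y with <-cmp x y
  ... | tri< x<y _ _ = c ∈₂? φ x y x<y
  ... | tri≈ _ _ _   = no λ ()
  ... | tri> _ _ y<x = c ∈₂? φ y x y<x

  colourClass-sym : ∀ {c} → Symmetric (ColourClass c)
  colourClass-sym {c} {x} {y} c∈xy with <-cmp x y | <-cmp y x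
  ... | tri< x<y _ _ | tri> _ _ x<y′ = subst (λ h → c ∈₂ φ x y h) (<ᶠ-irrelevant x<y x<y′) c∈xy
  ... | tri> _ _ y<x | tri< y<x′ _ _ = subst (λ h → c ∈₂ φ y x h) (<ᶠ-irrelevant y<x y<x′) c∈xy
  ... | tri< x<y _ _ | tri< y<x _ _  = contradiction y<x (<-asym x<y)
  ... | tri< _ x≢y _ | tri≈ _ y≡x _  = contradiction (sym y≡x) x≢y
  ... | tri> _ _ y<x | tri> _ _ x<y  = contradiction y<x (<-asym x<y)
  ... | tri> _ x≢y _ | tri≈ _ y≡x _  = contradiction (sym y≡x) x≢y

  colourClass-irrefl : ∀ {c x} → ¬ ColourClass c x x
  colourClass-irrefl {c} {x} with <-cmp x x
  ... | tri< x<x _ _ = contradiction x<x (<-irrefl refl)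
  ... | tri≈ _ _ _   = λ ()
  ... | tri> _ _ x<x = contradiction x<x (<-irrefl refl)

  edge-colours : ∀ {x y} → x ≢ y → Colours2
  edge-colours {x} {y} x≢y with <-cmp x y
  ... | tri< x<y _ _ = φ x y x<y
  ... | tri≈ _ x≡y _ = contradiction x≡y x≢y
  ... | tri> _ _ y<x = φ y x y<x

  edge-colours-≐ : ∀ {x y} (x≢y : x ≢ y) → (λ c → ColourClass c x y) ≐ (_∈₂ edge-colours x≢y)
  edge-colours-≐ {x} {y} x≢y with <-cmp x y
  ... | tri< _ _ _   = (λ c∈ → c∈) , (λ c∈ → c∈)
  ... | tri≈ _ x≡y _ = contradiction x≡y x≢y
  ... | tri> _ _ _   = (λ c∈ → c∈) , (λ c∈ → c∈)

  colourClass-< : ∀ {c x y} (x<y : x <ᶠ y) → ColourClass c x y → c ∈₂ φ x y x<y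
  colourClass-< {c} {x} {y} x<y c∈xy with <-cmp x y
  ... | tri< x<y′ _ _ = subst (λ h → c ∈₂ φ x y h) (<ᶠ-irrelevant x<y′ x<y) c∈xy
  ... | tri≈ _ _ _    = ⊥-elim c∈xy
  ... | tri> _ _ y<x  = contradiction y<x (<-asym x<y)

  ColourTriangle : Set
  ColourTriangle = ∃[ c ] ∃[ x ] ∃[ y ] ∃[ z ] (ColourClass c x y × ColourClass c y z × ColourClass c x z)

  colourTriangle? : Dec ColourTriangle
  colourTriangle? = any? λ c → any? λ x → any? λ y → any? λ z →
    colourClass? c x y ×-dec colourClass? c y z ×-dec colourClass? c x z

  ¬colourTriangle⇒triangle-free : ¬ ColourTriangle → ∀ c → TriangleFree (ColourClass c)
  ¬colourTriangle⇒triangle-free no-triangle c xy yz xz = no-triangle (c , _ , _ , _ , xy , yz , xz)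

  colourTriangle⇒mono : ColourTriangle → HasMonoTriangle φ
  colourTriangle⇒mono (c , _ , _ , _ , xy , yz , xz) with sort-triangle colourClass-sym colourClass-irrefl xy yz xz
  ... | i , j , k , i<j , j<k , ij , jk , ik =
    i , j , k , i<j , j<k , <ᶠ-trans i<j j<k , c ,
    colourClass-< i<j ij , colourClass-< j<k jk , colourClass-< (<ᶠ-trans i<j j<k) ik

module _ {m} (φ : Colouring42 (suc m)) where

  colour-degree-sum : ∀ x → ∑[ c < 4 ] degree (colourClass? φ c) x ≡ m * 2
  colour-degree-sum x = begin
    ∑[ c < 4 ] ∑[ y < suc m ] indicator (colourClass? φ c x) y   ≡⟨ ∑-comm (λ c y → indicator (colourClass? φ c x) y) ⟩
    ∑[ y < suc m ] edge-degree y                                 ≡⟨ sum-remove edge-degree ⟩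
    edge-degree x + ∑[ j < m ] edge-degree (punchIn x j)         ≡⟨ cong₂ _+_ loop-degree (sum-cong-≗ proper-degree) ⟩
    0 + ∑[ j < m ] 2                                             ≡⟨ ∑-const m 2 ⟩
    m * 2                                                        ∎
    where
    open ≡-Reasoning
    edge-degree : Fin (suc m) → ℕ
    edge-degree y = count (λ c → colourClass? φ c x y)
    loop-degree : edge-degree x ≡ 0
    loop-degree = count-∅ (λ c → colourClass? φ c x x) (λ c → colourClass-irrefl φ)
    proper-degree : ∀ j → edge-degree (punchIn x j) ≡ 2
    proper-degree j = trans (count-cong (λ c → colourClass? φ c x (punchIn x j)) (_∈₂? p) (edge-colours-≐ φ x≢y)) (count-∈₂ p)
      where
      x≢y = punchInᵢ≢i x j ∘ sym
      p = edge-colours φ x≢y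

module _ {n} (φ : Colouring42 n) (triangle-free : ∀ c → TriangleFree (ColourClass φ c)) where

  private
    module Star (c : Fin 4) {x y} (x~y : ColourClass φ c x y) where

      M : Pred (Fin n) 0ℓ
      M = ColourClass φ c x ∩ ∁ ｛ y ｝

      M? : Decidable M
      M? = colourClass? φ c x ∩? ∁? (y ≟_)

      M-off-colour : ∀ {z} → M z → ¬ ColourClass φ c y z
      M-off-colour (x~z , _) y~z = triangle-free c x~y y~z x~z

      -- Each z ∈ M lies in K c, and in exactly one other K d, as yz carries two of the three colours ≠ c.
      K : Fin 4 → Pred (Fin n) 0ℓ
      K d = M ∩ ∁ (ColourClass φ d y)

      K? : ∀ d → Decidable (K d)
      K? d = M? ∩? ∁? (colourClass? φ d y)

      count-K-sum : ∑[ d < 4 ] count (K? d) ≡ count M? + count M?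
      count-K-sum = begin
        ∑[ d < 4 ] ∑[ z < n ] indicator (K? d) z              ≡⟨ ∑-comm (λ d z → indicator (K? d) z) ⟩
        ∑[ z < n ] count (λ d → K? d z)                       ≡⟨ sum-cong-≗ missing-colours ⟩
        ∑[ z < n ] (indicator M? z + indicator M? z)          ≡⟨ ∑-distrib-+ (indicator M?) (indicator M?) ⟩
        count M? + count M?                                   ∎
        where
        open ≡-Reasoning
        missing-colours : ∀ z → count (λ d → K? d z) ≡ indicator M? z + indicator M? z
        missing-colours z with M? z
        ... | no  z∉M = begin
          count (λ d → K? d z)                ≡⟨ count-∅ (λ d → K? d z) (λ d (z∈M , _) → z∉M z∈M) ⟩
          0 + 0                               ≡⟨ cong₂ _+_ (indicator-no M? z∉M) (indicator-no M? z∉M) ⟨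
          indicator M? z + indicator M? z     ∎
        ... | yes z∈M = begin
          count (λ d → K? d z)                ≡⟨ count-cong (λ d → K? d z) (∁? (_∈₂? p)) (K⊆∁p , ∁p⊆K) ⟩
          count (∁? (_∈₂? p))                 ≡⟨ count-∉₂ p ⟩
          1 + 1                               ≡⟨ cong₂ _+_ (indicator-yes M? z∈M) (indicator-yes M? z∈M) ⟨
          indicator M? z + indicator M? z     ∎
          where
          p = edge-colours φ (proj₂ z∈M)
          yz⊆p = proj₁ (edge-colours-≐ φ (proj₂ z∈M))
          p⊆yz = proj₂ (edge-colours-≐ φ (proj₂ z∈M))
          K⊆∁p : ∀ {d} → K d z → ¬ d ∈₂ p
          K⊆∁p (_ , d∉yz) d∈p = d∉yz (p⊆yz d∈p)
          ∁p⊆K : ∀ {d} → ¬ d ∈₂ p → K d z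
          ∁p⊆K d∉p = z∈M , d∉p ∘ yz⊆p

      count-Kc : count (K? c) ≡ count M?
      count-Kc = count-cong (K? c) M? (proj₁ , λ z∈M → z∈M , M-off-colour z∈M)

      M-independent : ∀ {z₁ z₂} → M z₁ → M z₂ → ¬ ColourClass φ c z₁ z₂
      M-independent (x~z₁ , _) (x~z₂ , _) z₁~z₂ = triangle-free c x~z₁ z₁~z₂ x~z₂

      K-at-most-one : ∀ {d} → c ≢ d → ∀ {z₁ z₂} → z₁ ≢ z₂ → K d z₁ → ¬ K d z₂
      K-at-most-one c≢d z₁≢z₂ (z₁∈M , d∉yz₁) (z₂∈M , d∉yz₂) =
        triangle-free e (p₁⊆yz₁ e∈p₁) (p₃⊆z₁z₂ e∈p₃) (p₂⊆yz₂ e∈p₂)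
        where
        p₁⊆yz₁ = proj₂ (edge-colours-≐ φ (proj₂ z₁∈M))
        p₂⊆yz₂ = proj₂ (edge-colours-≐ φ (proj₂ z₂∈M))
        p₃⊆z₁z₂ = proj₂ (edge-colours-≐ φ z₁≢z₂)
        shared = common-colour (edge-colours φ (proj₂ z₁∈M)) (edge-colours φ (proj₂ z₂∈M)) (edge-colours φ z₁≢z₂) c≢d
                   (M-off-colour z₁∈M ∘ p₁⊆yz₁) (d∉yz₁ ∘ p₁⊆yz₁)
                   (M-off-colour z₂∈M ∘ p₂⊆yz₂) (d∉yz₂ ∘ p₂⊆yz₂)
                   (M-independent z₁∈M z₂∈M ∘ p₃⊆z₁z₂)
        e = proj₁ shared
        e∈p₁ = proj₁ (proj₂ shared)
        e∈p₂ = proj₁ (proj₂ (proj₂ shared))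
        e∈p₃ = proj₂ (proj₂ (proj₂ shared))

      other-K-sum : ∑[ j < 3 ] count (K? (punchIn c j)) ≡ count M?
      other-K-sum = +-cancelˡ-≡ (count M?) _ _ (begin
        count M? + ∑[ j < 3 ] count (K? (punchIn c j))       ≡⟨ cong (_+ ∑[ j < 3 ] count (K? (punchIn c j))) count-Kc ⟨
        count (K? c) + ∑[ j < 3 ] count (K? (punchIn c j))   ≡⟨ sum-remove (λ d → count (K? d)) ⟨
        ∑[ d < 4 ] count (K? d)                              ≡⟨ count-K-sum ⟩
        count M? + count M?                                  ∎)
        where open ≡-Reasoning

      count-M≤3 : count M? ≤ 3
      count-M≤3 = ≮⇒≥ λ 3<M → two-in-K (pigeonhole-∑ (λ j → count (K? (punchIn c j))) (subst (3 <_) (sym other-K-sum) 3<M))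
        where
        two-in-K : ¬ (∃[ j ] 1 < count (K? (punchIn c j)))
        two-in-K (j , 1<K) with count-two (K? (punchIn c j)) 1<K
        ... | z₁ , z₂ , z₁≢z₂ , z₁∈K , z₂∈K = K-at-most-one (punchInᵢ≢i c j ∘ sym) z₁≢z₂ z₁∈K z₂∈K

  colour-degree≤4 : ∀ c x → degree (colourClass? φ c) x ≤ 4
  colour-degree≤4 c x with any? (colourClass? φ c x)
  ... | no  isolated = ≤-trans (≤-reflexive (count-∅ (colourClass? φ c x) λ y x~y → isolated (y , x~y))) z≤n
  ... | yes (y , x~y) = ≤-trans (count-∖｛｝ (colourClass? φ c x) y) (s≤s (Star.count-M≤3 c x~y))

-- The upper bound

colour-degree≡4 : (φ : Colouring42 9) → (∀ c → TriangleFree (ColourClass φ c)) → ∀ c x → degree (colourClass? φ c) x ≡ 4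
colour-degree≡4 φ triangle-free c x =
  ∑-≤-*⇒≡ {f = λ c → degree (colourClass? φ c) x} (λ c → colour-degree≤4 φ triangle-free c x)
          (≤-reflexive (sym (colour-degree-sum φ x))) c

colour-classes-not-triangle-free : (φ : Colouring42 9) → ¬ (∀ c → TriangleFree (ColourClass φ c))
colour-classes-not-triangle-free φ triangle-free =
  4≰2 (regular-triangle-free⇒≤2 {d = 4} (colourClass? φ 0F) (colourClass-sym φ) (colourClass-irrefl φ)
                                          (triangle-free 0F) (colour-degree≡4 φ triangle-free 0F))
  where
  4≰2 : ¬ 4 ≤ 2
  4≰2 (s≤s (s≤s ()))

arrows-9 : Arrows 9
arrows-9 φ = colourTriangle⇒mono φ (decidable-stable (colourTriangle? φ)
               (colour-classes-not-triangle-free φ ∘ ¬colourTriangle⇒triangle-free φ))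

-- The lower bound

Arrows-mono : ∀ {m n} → m ≤ n → Arrows m → Arrows n
Arrows-mono {m} {n} m≤n arrows φ = lift (arrows restriction)
  where
  ι : Fin m → Fin n
  ι i = inject≤ i m≤n
  ι-mono : ∀ {i j} → i <ᶠ j → ι i <ᶠ ι j
  ι-mono {i} {j} = subst₂ ℕ._<_ (sym (toℕ-inject≤ i m≤n)) (sym (toℕ-inject≤ j m≤n))
  restriction : Colouring42 m
  restriction i j i<j = φ (ι i) (ι j) (ι-mono i<j)
  lift : HasMonoTriangle restriction → HasMonoTriangle φ
  lift (i , j , k , i<j , j<k , i<k , c , c∈ij , c∈jk , c∈ik) =
    ι i , ι j , ι k , ι-mono i<j , ι-mono j<k , ι-mono i<k , c , c∈ij , c∈jk , c∈ik

-- cᵢⱼ is the pair {i, j} of the paper's colours 1, …, 4, i.e. of the indices i − 1, j − 1 in Fin 4.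
c₁₂ c₁₃ c₁₄ c₂₃ c₂₄ c₃₄ : Colours2
c₁₂ = 0F , 1F , z<s
c₁₃ = 0F , 2F , z<s
c₁₄ = 0F , 3F , z<s
c₂₃ = 1F , 2F , s<s z<s
c₂₄ = 1F , 3F , s<s z<s
c₃₄ = 2F , 3F , s<s (s<s z<s)

-- Symmetric; its diagonal is never read.
ψ₈-table : Vec (Vec Colours2 8) 8
ψ₈-table =
  (c₁₂ ∷ c₁₂ ∷ c₃₄ ∷ c₂₃ ∷ c₁₃ ∷ c₂₃ ∷ c₁₄ ∷ c₂₄ ∷ []) ∷
  (c₁₂ ∷ c₁₂ ∷ c₁₄ ∷ c₃₄ ∷ c₂₃ ∷ c₁₃ ∷ c₂₄ ∷ c₁₄ ∷ []) ∷
  (c₃₄ ∷ c₁₄ ∷ c₁₂ ∷ c₁₂ ∷ c₁₄ ∷ c₂₄ ∷ c₁₃ ∷ c₂₃ ∷ []) ∷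
  (c₂₃ ∷ c₃₄ ∷ c₁₂ ∷ c₁₂ ∷ c₂₄ ∷ c₁₄ ∷ c₂₃ ∷ c₁₃ ∷ []) ∷
  (c₁₃ ∷ c₂₃ ∷ c₁₄ ∷ c₂₄ ∷ c₁₂ ∷ c₁₂ ∷ c₃₄ ∷ c₃₄ ∷ []) ∷
  (c₂₃ ∷ c₁₃ ∷ c₂₄ ∷ c₁₄ ∷ c₁₂ ∷ c₁₂ ∷ c₂₄ ∷ c₃₄ ∷ []) ∷
  (c₁₄ ∷ c₂₄ ∷ c₁₃ ∷ c₂₃ ∷ c₃₄ ∷ c₂₄ ∷ c₁₂ ∷ c₁₂ ∷ []) ∷
  (c₂₄ ∷ c₁₄ ∷ c₂₃ ∷ c₁₃ ∷ c₃₄ ∷ c₃₄ ∷ c₁₂ ∷ c₁₂ ∷ []) ∷ []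

ψ₈-edge : Fin 8 → Fin 8 → Colours2
ψ₈-edge i j = lookup (lookup ψ₈-table i) j

ψ₈ : Colouring42 8
ψ₈ i j _ = ψ₈-edge i j

ψ₈-mono-free : ¬ HasMonoTriangle ψ₈
ψ₈-mono-free (i , j , k , i<j , j<k , _ , c , c∈ij , c∈jk , c∈ik) = from-no
  (any? λ i → any? λ j → any? λ k → any? λ c →
    (i <ᶠ? j) ×-dec (j <ᶠ? k) ×-dec (c ∈₂? ψ₈-edge i j) ×-dec (c ∈₂? ψ₈-edge j k) ×-dec (c ∈₂? ψ₈-edge i k))
  (i , j , k , c , i<j , j<k , c∈ij , c∈jk , c∈ik)

¬arrows-8 : ¬ Arrows 8
¬arrows-8 arrows = ψ₈-mono-free (arrows ψ₈)

corollary6p3 : R42K3≡ 9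
corollary6p3 = arrows-9 , λ m m<9 → ¬arrows-8 ∘ Arrows-mono (s≤s⁻¹ m<9)
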